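{- Let $n\geq 2$ and $v\geq 2$ be integers, and let $G$ be a strongly $(n,v)$-clique-partitioned graph. Then the number of edges of $G$ is at most \[\frac{n}{2}v(v-1)+\frac{nv(n-1)(v-2)}{2}.\]
   Context: A $v$-clique is a set of $v$ pairwise adjacent vertices (a complete subgraph on $v$ vertices). A graph $G$ of order $nv$ is weakly $(n,v)$-clique-partitioned if its vertex set can be decomposed in a unique way into $n$ vertex-disjoint $v$-cliques. It is strongly $(n,v)$-clique-partitioned if it is weakly $(n,v)$-clique-partitioned and, in addition, the only $v$-cliques in $G$ are the $n$ cliques of that decomposition. Graphs are finite and simple. -}

module Defs where

open import Data.Nat using (ℕ; _+_; _*_)
open import Data.Bool using (Bool; true; false; _∧_; if_then_else_)
open import Data.Fin using (Fin; _<?_)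
open import Data.Fin.Subset using (Subset; _∈_; ∣_∣)
open import Data.List using (List; map; allFin)
open import Data.Nat.ListAction using (sum)
open import Data.Product using (Σ; ∃; _×_)
open import Relation.Binary.PropositionalEquality using (_≡_; _≢_)
open import Relation.Nullary.Decidable using (⌊_⌋)

record Graph (N : ℕ) : Set where
  field
    adj   : Fin N → Fin N → Bool
    sym   : ∀ x y → adj x y ≡ adj y x
    irrefl : ∀ x → adj x x ≡ false

open Graph public

Adjacent : {N : ℕ} → Graph N → Fin N → Fin N → Set
Adjacent G x y = adj G x y ≡ true

edgeCount : {N : ℕ} → Graph N → ℕ
edgeCount {N} G =
  sum (map (λ x → sum (map (λ y → if ⌊ x <? y ⌋ ∧ adj G x y then 1 else 0)
                           (allFin N)))
           (allFin N))

IsClique : {N : ℕ} → Graph N → Subset N → Set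
IsClique G S = ∀ x y → x ∈ S → y ∈ S → x ≢ y → Adjacent G x y

IsVClique : {N : ℕ} → Graph N → ℕ → Subset N → Set
IsVClique G v S = IsClique G S × ∣ S ∣ ≡ v

IsCliquePartition : {N : ℕ} → Graph N → (n v : ℕ) → (Fin n → Subset N) → Set
IsCliquePartition {N} G n v P =
  (∀ i → IsVClique G v (P i)) ×
  (∀ i j (x : Fin N) → x ∈ P i → x ∈ P j → i ≡ j) ×
  (∀ (x : Fin N) → ∃ λ i → x ∈ P i)

-- Two decompositions are the same decomposition (as unordered sets of cliques)
SameDecomposition : {N n : ℕ} → (Fin n → Subset N) → (Fin n → Subset N) → Set
SameDecomposition P Q = (∀ i → ∃ λ j → P i ≡ Q j) × (∀ j → ∃ λ i → Q j ≡ P i)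

WeaklyCliquePartitioned : (n v : ℕ) → Graph (n * v) → Set
WeaklyCliquePartitioned n v G =
  Σ (Fin n → Subset (n * v)) λ P →
    IsCliquePartition G n v P ×
    (∀ Q → IsCliquePartition G n v Q → SameDecomposition P Q)

StronglyCliquePartitioned : (n v : ℕ) → Graph (n * v) → Set
StronglyCliquePartitioned n v G =
  Σ (Fin n → Subset (n * v)) λ P →
    IsCliquePartition G n v P ×
    (∀ Q → IsCliquePartition G n v Q → SameDecomposition P Q) ×
    (∀ S → IsVClique G v S → ∃ λ i → S ≡ P i)

-- Every vertex x has at most v − 1 neighbours in its own clique and at most
-- v − 2 in any other clique C: were x adjacent to all of C except possibly one
-- vertex y, then (C − y) ∪ {x} would be a v-clique outside the decomposition.
-- Hence deg x ≤ n (v − 2) + 1, and summing over the nv vertices bounds 2|E|.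
-- The argument does not need n ≥ 2.
module Submission where

open import Data.Bool using (Bool; true; _∧_; if_then_else_)
import Data.Bool as Bool
open import Data.Bool.Properties using (∧-identityʳ)
open import Data.Empty using (⊥-elim)
open import Data.Fin using (Fin; zero; suc; _≟_; _<?_)
open import Data.Fin.Properties using (any?; <-cmp; <-asym; suc-injective)
open import Data.Fin.Subset
  using (Subset; inside; outside; _∈_; _∉_; _⊆_; ∣_∣; _∩_; _∪_; _-_; ⁅_⁆)
open import Data.Fin.Subset.Properties
  using ( _∈?_; x∈⁅x⁆; x∈⁅y⁆⇒x≡y; ∣⁅x⁆∣≡1; p⊆q⇒∣p∣≤∣q∣; p⊂q⇒∣p∣<∣q∣
        ; p∩q⊆q; x∈p∩q⁻; x∈p∪q⁻; x∈p∪q⁺; p─q⊆p; p─⊥≡p; ∪-identityʳ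
        ; x∈p∧x≢y⇒x∈p-y)
open import Data.List as List using (map; allFin)
open import Data.List.Properties using (map-tabulate)
open import Data.Nat.ListAction using () renaming (sum to sumᴸ)
open import Data.Nat using (ℕ; zero; suc; _+_; _*_; _∸_; _≤_; _<_; z≤n; s≤s)
open import Data.Nat.Properties
  using ( +-0-commutativeMonoid; +-mono-≤; ≤-trans; ≤-reflexive; m≤m+n; m≤n+m
        ; +-identityʳ; +-suc; module ≤-Reasoning)
open import Algebra.Properties.CommutativeMonoid.Sum +-0-commutativeMonoid
  using (sum-syntax; sum-cong-≗; ∑-distrib-+; ∑-comm)
open import Data.Nat.Tactic.RingSolver using (solve-∀)
open import Data.Product using (∃; _×_; _,_; proj₁; proj₂)
open import Data.Sum as Sum using (_⊎_; inj₁; inj₂)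
open import Data.Vec using ([]; _∷_; lookup; tabulate; here; there)
open import Data.Vec.Properties using (lookup∘tabulate; lookup-zipWith; []=⇒lookup)
open import Function using (_∘_)
open import Relation.Binary using (tri<; tri≈; tri>)
open import Relation.Binary.PropositionalEquality
  using (_≡_; _≢_; refl; sym; trans; cong; subst; module ≡-Reasoning)
open import Relation.Nullary using (¬_; yes; no; contradiction; ¬?; _×-dec_)
open import Relation.Nullary.Decidable using (⌊_⌋; decidable-stable)

open import Defs hiding (sym; irrefl)
open Graph using () renaming (sym to adj-sym; irrefl to adj-irrefl)

private
  variable
    n N v c : ℕ

𝟙 : Bool → ℕ
𝟙 b = if b then 1 else 0

∑-mono-≤ : {f g : Fin n → ℕ} → (∀ i → f i ≤ g i) → ∑[ i < n ] f i ≤ ∑[ i < n ] g i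
∑-mono-≤ {zero}  f≤g = z≤n
∑-mono-≤ {suc n} f≤g = +-mono-≤ (f≤g zero) (∑-mono-≤ (f≤g ∘ suc))

term≤∑ : (f : Fin n → ℕ) (i : Fin n) → f i ≤ ∑[ j < n ] f j
term≤∑ f zero    = m≤m+n _ _
term≤∑ f (suc i) = ≤-trans (term≤∑ (f ∘ suc) i) (m≤n+m _ _)

∑≤* : {f : Fin n → ℕ} → (∀ i → f i ≤ c) → ∑[ i < n ] f i ≤ n * c
∑≤* {zero}  f≤c = z≤n
∑≤* {suc n} f≤c = +-mono-≤ (f≤c zero) (∑≤* (f≤c ∘ suc))

∑≤*+1 : (f : Fin n → ℕ) (i : Fin n) → f i ≤ suc c → (∀ j → j ≢ i → f j ≤ c) →
        ∑[ j < n ] f j ≤ suc (n * c)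
∑≤*+1 f zero    fi≤ others = +-mono-≤ fi≤ (∑≤* (λ j → others (suc j) λ ()))
∑≤*+1 f (suc i) fi≤ others = ≤-trans
  (+-mono-≤ (others zero λ ())
            (∑≤*+1 (f ∘ suc) i fi≤ (λ j j≢i → others (suc j) (j≢i ∘ suc-injective))))
  (≤-reflexive (+-suc _ _))

sum-allFin : (f : Fin n → ℕ) → sumᴸ (map f (allFin n)) ≡ ∑[ i < n ] f i
sum-allFin f = trans (cong sumᴸ (map-tabulate (λ i → i) f)) (sum-tabulate f)
  where
  sum-tabulate : (f : Fin n → ℕ) → sumᴸ (List.tabulate f) ≡ ∑[ i < n ] f i
  sum-tabulate {zero}  f = refl
  sum-tabulate {suc n} f = cong (f zero +_) (sum-tabulate (f ∘ suc))

∣p∣≡∑𝟙 : (p : Subset n) → ∣ p ∣ ≡ ∑[ x < n ] 𝟙 (lookup p x)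
∣p∣≡∑𝟙 []            = refl
∣p∣≡∑𝟙 (inside  ∷ p) = cong suc (∣p∣≡∑𝟙 p)
∣p∣≡∑𝟙 (outside ∷ p) = ∣p∣≡∑𝟙 p

x∈p⇒suc∣p-x∣≡∣p∣ : {p : Subset n} {x : Fin n} → x ∈ p → suc ∣ p - x ∣ ≡ ∣ p ∣
x∈p⇒suc∣p-x∣≡∣p∣ {p = inside  ∷ p} here        = cong (suc ∘ ∣_∣) (p─⊥≡p p)
x∈p⇒suc∣p-x∣≡∣p∣ {p = inside  ∷ p} (there x∈p) = cong suc (x∈p⇒suc∣p-x∣≡∣p∣ x∈p)
x∈p⇒suc∣p-x∣≡∣p∣ {p = outside ∷ p} (there x∈p) = x∈p⇒suc∣p-x∣≡∣p∣ x∈p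

x∉p⇒∣p∪⁅x⁆∣≡suc∣p∣ : {p : Subset n} {x : Fin n} → x ∉ p → ∣ p ∪ ⁅ x ⁆ ∣ ≡ suc ∣ p ∣
x∉p⇒∣p∪⁅x⁆∣≡suc∣p∣ {p = outside ∷ p} {zero}  x∉p = cong (suc ∘ ∣_∣) (∪-identityʳ p)
x∉p⇒∣p∪⁅x⁆∣≡suc∣p∣ {p = inside  ∷ p} {zero}  x∉p = contradiction here x∉p
x∉p⇒∣p∪⁅x⁆∣≡suc∣p∣ {p = outside ∷ p} {suc x} x∉p = x∉p⇒∣p∪⁅x⁆∣≡suc∣p∣ (x∉p ∘ there)
x∉p⇒∣p∪⁅x⁆∣≡suc∣p∣ {p = inside  ∷ p} {suc x} x∉p = cong suc (x∉p⇒∣p∪⁅x⁆∣≡suc∣p∣ (x∉p ∘ there))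

x∈p-y⇒x≢y : {p : Subset n} {x y : Fin n} → x ∈ p - y → x ≢ y
x∈p-y⇒x≢y {p = _ ∷ p} {suc x} {suc y} (there x∈p-y) refl = x∈p-y⇒x≢y x∈p-y refl

2≤∣p∣⇒∃≢ : {p : Subset n} → 2 ≤ ∣ p ∣ → (y : Fin n) → ∃ λ x → x ∈ p × x ≢ y
2≤∣p∣⇒∃≢ {p = p} 2≤∣p∣ y with any? (λ x → x ∈? p ×-dec ¬? (x ≟ y))
... | yes found = found
... | no none = contradiction (≤-trans 2≤∣p∣ ∣p∣≤1) λ { (s≤s ()) }
  where
  p⊆⁅y⁆ : p ⊆ ⁅ y ⁆
  p⊆⁅y⁆ {x} x∈p = subst (_∈ ⁅ y ⁆)
    (sym (decidable-stable (x ≟ y) (λ x≢y → none (x , x∈p , x≢y)))) (x∈⁅x⁆ y)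
  ∣p∣≤1 : ∣ p ∣ ≤ 1
  ∣p∣≤1 = ≤-trans (p⊆q⇒∣p∣≤∣q∣ p⊆⁅y⁆) (≤-reflexive (∣⁅x⁆∣≡1 y))

two-missing⇒2+∣p∣≤∣q∣ : {p q : Subset n} {a b : Fin n} → p ⊆ q →
  a ∈ q → b ∈ q → a ∉ p → b ∉ p → b ≢ a → 2 + ∣ p ∣ ≤ ∣ q ∣
two-missing⇒2+∣p∣≤∣q∣ {p = p} {q} {a} {b} p⊆q a∈q b∈q a∉p b∉p b≢a = begin
  2 + ∣ p ∣         ≤⟨ s≤s (s≤s (p⊆q⇒∣p∣≤∣q∣ p⊆q-a-b)) ⟩
  2 + ∣ q - a - b ∣ ≡⟨ cong suc (x∈p⇒suc∣p-x∣≡∣p∣ (x∈p∧x≢y⇒x∈p-y b∈q b≢a)) ⟩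
  suc ∣ q - a ∣     ≡⟨ x∈p⇒suc∣p-x∣≡∣p∣ a∈q ⟩
  ∣ q ∣             ∎
  where
  open ≤-Reasoning
  p⊆q-a-b : p ⊆ q - a - b
  p⊆q-a-b x∈p = x∈p∧x≢y⇒x∈p-y
    (x∈p∧x≢y⇒x∈p-y (p⊆q x∈p) λ { refl → a∉p x∈p })
    λ { refl → b∉p x∈p }

∣p∣≤∑∣p∩P∣ : {P : Fin n → Subset N} → (∀ x → ∃ λ j → x ∈ P j) →
  (p : Subset N) → ∣ p ∣ ≤ ∑[ j < n ] ∣ p ∩ P j ∣
∣p∣≤∑∣p∩P∣ {n} {N} {P} covers p = begin
  ∣ p ∣                              ≡⟨ ∣p∣≡∑𝟙 p ⟩
  ∑[ x < N ] 𝟙 (lookup p x)          ≤⟨ ∑-mono-≤ in-some-part ⟩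
  ∑[ x < N ] ∑[ j < n ] 𝟙 (p∩P j x)  ≡⟨ ∑-comm (λ x j → 𝟙 (p∩P j x)) ⟩
  ∑[ j < n ] ∑[ x < N ] 𝟙 (p∩P j x)  ≡⟨ sum-cong-≗ (λ j → sym (∣p∣≡∑𝟙 (p ∩ P j))) ⟩
  ∑[ j < n ] ∣ p ∩ P j ∣             ∎
  where
  open ≤-Reasoning
  p∩P : Fin n → Fin N → Bool
  p∩P j = lookup (p ∩ P j)
  in-some-part : ∀ x → 𝟙 (lookup p x) ≤ ∑[ j < n ] 𝟙 (p∩P j x)
  in-some-part x with covers x
  ... | j , x∈Pj = ≤-trans (≤-reflexive (cong 𝟙 p[x]≡)) (term≤∑ (λ j → 𝟙 (p∩P j x)) j)
    where
    p[x]≡ : lookup p x ≡ p∩P j x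
    p[x]≡ = sym (trans (lookup-zipWith _∧_ x p (P j))
                       (trans (cong (lookup p x ∧_) ([]=⇒lookup x∈Pj)) (∧-identityʳ _)))

neighbours : Graph N → Fin N → Subset N
neighbours G x = tabulate (adj G x)

degree : Graph N → Fin N → ℕ
degree G x = ∣ neighbours G x ∣

neighbours-adjacent : (G : Graph N) {x y : Fin N} → y ∈ neighbours G x → Adjacent G x y
neighbours-adjacent G {x} {y} y∈ = trans (sym (lookup∘tabulate (adj G x) y)) ([]=⇒lookup y∈)

module _ (G : Graph N) where

  𝟙-adj≡ : ∀ x y → 𝟙 (adj G x y) ≡ 𝟙 (⌊ x <? y ⌋ ∧ adj G x y) + 𝟙 (⌊ y <? x ⌋ ∧ adj G y x)
  𝟙-adj≡ x y with x <? y | y <? x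
  ... | yes x<y | yes y<x = ⊥-elim (<-asym x<y y<x)
  ... | yes _   | no _    = sym (+-identityʳ _)
  ... | no _    | yes _   rewrite adj-sym G y x = refl
  ... | no x≮y  | no y≮x  with <-cmp x y
  ...   | tri< x<y _ _ = contradiction x<y x≮y
  ...   | tri≈ _ refl _ rewrite adj-irrefl G x = refl
  ...   | tri> _ _ y<x = contradiction y<x y≮x

  handshake : 2 * edgeCount G ≡ ∑[ x < N ] degree G x
  handshake = begin
    2 * edgeCount G
      ≡⟨ cong (2 *_) edgeCount≡ ⟩
    E + (E + 0)
      ≡⟨ cong (E +_) (trans (+-identityʳ E) (∑-comm e)) ⟩
    E + ∑[ x < N ] ∑[ y < N ] e y x
      ≡⟨ sym (∑-distrib-+ (λ x → ∑[ y < N ] e x y) (λ x → ∑[ y < N ] e y x)) ⟩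
    ∑[ x < N ] (∑[ y < N ] e x y + ∑[ y < N ] e y x)
      ≡⟨ sum-cong-≗ (λ x → sym (∑-distrib-+ (e x) (λ y → e y x))) ⟩
    ∑[ x < N ] ∑[ y < N ] (e x y + e y x)
      ≡⟨ sum-cong-≗ (λ x → sum-cong-≗ (λ y → sym (𝟙-adj≡ x y))) ⟩
    ∑[ x < N ] ∑[ y < N ] 𝟙 (adj G x y)
      ≡⟨ sum-cong-≗ (λ x → sym (degree≡ x)) ⟩
    ∑[ x < N ] degree G x
      ∎
    where
    open ≡-Reasoning
    e : Fin N → Fin N → ℕ
    e x y = 𝟙 (⌊ x <? y ⌋ ∧ adj G x y)
    E : ℕ
    E = ∑[ x < N ] ∑[ y < N ] e x y
    edgeCount≡ : edgeCount G ≡ E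
    edgeCount≡ = trans (sum-allFin (λ x → sumᴸ (map (e x) (allFin N))))
                       (sum-cong-≗ (sum-allFin ∘ e))
    degree≡ : ∀ x → degree G x ≡ ∑[ y < N ] 𝟙 (adj G x y)
    degree≡ x = trans (∣p∣≡∑𝟙 (neighbours G x))
                      (sum-cong-≗ (cong 𝟙 ∘ lookup∘tabulate (adj G x)))

  2*edgeCount≤ : ∀ {d} → (∀ x → degree G x ≤ d) → 2 * edgeCount G ≤ N * d
  2*edgeCount≤ degree≤d = subst (_≤ _) (sym handshake) (∑≤* degree≤d)

  exchange-clique : ∀ {v p x y} → IsVClique G v p → y ∈ p → x ∉ p →
    (∀ z → z ∈ p → z ≢ y → Adjacent G x z) → IsVClique G v ((p - y) ∪ ⁅ x ⁆)
  exchange-clique {v} {p} {x} {y} (p-clique , ∣p∣≡v) y∈p x∉p x-adj = clique , size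
    where
    p-y⊆p : p - y ⊆ p
    p-y⊆p = p─q⊆p p ⁅ y ⁆
    adjacent-x : ∀ {z} → z ∈ p - y → Adjacent G x z
    adjacent-x z∈ = x-adj _ (p-y⊆p z∈) (x∈p-y⇒x≢y z∈)
    in-T : ∀ {w} → w ∈ (p - y) ∪ ⁅ x ⁆ → w ∈ p - y ⊎ w ≡ x
    in-T = Sum.map₂ (x∈⁅y⁆⇒x≡y x) ∘ x∈p∪q⁻ (p - y) ⁅ x ⁆
    clique : IsClique G ((p - y) ∪ ⁅ x ⁆)
    clique a b a∈ b∈ a≢b with in-T a∈ | in-T b∈
    ... | inj₁ a∈p-y | inj₁ b∈p-y = p-clique a b (p-y⊆p a∈p-y) (p-y⊆p b∈p-y) a≢b
    ... | inj₁ a∈p-y | inj₂ refl  = trans (adj-sym G a x) (adjacent-x a∈p-y)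
    ... | inj₂ refl  | inj₁ b∈p-y = adjacent-x b∈p-y
    ... | inj₂ refl  | inj₂ refl  = ⊥-elim (a≢b refl)
    size : ∣ (p - y) ∪ ⁅ x ⁆ ∣ ≡ v
    size = trans (x∉p⇒∣p∪⁅x⁆∣≡suc∣p∣ (x∉p ∘ p-y⊆p)) (trans (x∈p⇒suc∣p-x∣≡∣p∣ y∈p) ∣p∣≡v)

module StronglyPartitioned
  (G : Graph N) (P : Fin n → Subset N) (partition : IsCliquePartition G n v P)
  (only-parts : ∀ S → IsVClique G v S → ∃ λ i → S ≡ P i) (2≤v : 2 ≤ v) where

  part : Fin N → Fin n
  part x = proj₁ (proj₂ (proj₂ partition) x)

  x∈part : ∀ x → x ∈ P (part x)
  x∈part x = proj₂ (proj₂ (proj₂ partition) x)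

  same-part : ∀ {i j x} → x ∈ P i → x ∈ P j → i ≡ j
  same-part = proj₁ (proj₂ partition) _ _ _

  ∣P∣≡v : ∀ i → ∣ P i ∣ ≡ v
  ∣P∣≡v i = proj₂ (proj₁ partition i)

  other-member : ∀ i y → ∃ λ x → x ∈ P i × x ≢ y
  other-member i = 2≤∣p∣⇒∃≢ (subst (2 ≤_) (sym (∣P∣≡v i)) 2≤v)

  ¬adjacent-to-all-but-one : ∀ {x j y} → j ≢ part x → y ∈ P j →
    ¬ (∀ z → z ∈ P j → z ≢ y → Adjacent G x z)
  ¬adjacent-to-all-but-one {x} {j} {y} j≢part y∈Pj x-adj = j≢part (trans (sym k≡j) k≡part)
    where
    T : Subset N
    T = (P j - y) ∪ ⁅ x ⁆
    T-is-part : ∃ λ k → T ≡ P k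
    T-is-part = only-parts T (exchange-clique G (proj₁ partition j) y∈Pj
      (λ x∈Pj → j≢part (same-part x∈Pj (x∈part x))) x-adj)
    k : Fin n
    k = proj₁ T-is-part
    in-Pk : ∀ {w} → w ∈ T → w ∈ P k
    in-Pk = subst (_ ∈_) (proj₂ T-is-part)
    k≡part : k ≡ part x
    k≡part = same-part (in-Pk (x∈p∪q⁺ (inj₂ (x∈⁅x⁆ x)))) (x∈part x)
    k≡j : k ≡ j
    k≡j with other-member j y
    ... | w , w∈Pj , w≢y = same-part (in-Pk (x∈p∪q⁺ (inj₁ (x∈p∧x≢y⇒x∈p-y w∈Pj w≢y)))) w∈Pj

  ∃-non-neighbour : ∀ {x j y} → j ≢ part x → y ∈ P j →
    ∃ λ z → z ∈ P j × z ≢ y × ¬ Adjacent G x z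
  ∃-non-neighbour {x} {j} {y} j≢part y∈Pj
    with any? (λ z → z ∈? P j ×-dec ¬? (z ≟ y) ×-dec ¬? (adj G x z Bool.≟ true))
  ... | yes found = found
  ... | no none = contradiction adjacent-to-all-but-y (¬adjacent-to-all-but-one j≢part y∈Pj)
    where
    adjacent-to-all-but-y : ∀ z → z ∈ P j → z ≢ y → Adjacent G x z
    adjacent-to-all-but-y z z∈Pj z≢y =
      decidable-stable (adj G x z Bool.≟ true) (λ ¬adj → none (z , z∈Pj , z≢y , ¬adj))

  neighbours-in-own-part : ∀ x → ∣ neighbours G x ∩ P (part x) ∣ < v
  neighbours-in-own-part x = subst (∣ neighbours G x ∩ P (part x) ∣ <_) (∣P∣≡v (part x))
    (p⊂q⇒∣p∣<∣q∣ (p∩q⊆q _ _ , x , x∈part x , x∉neighbours))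
    where
    x∉neighbours : x ∉ neighbours G x ∩ P (part x)
    x∉neighbours x∈ = contradiction
      (trans (sym (adj-irrefl G x)) (neighbours-adjacent G (proj₁ (x∈p∩q⁻ _ _ x∈)))) λ ()

  neighbours-in-other-part : ∀ {x j} → j ≢ part x → 2 + ∣ neighbours G x ∩ P j ∣ ≤ v
  neighbours-in-other-part {x} {j} j≢part with other-member j x
  ... | y , y∈Pj , _ with ∃-non-neighbour j≢part y∈Pj
  ...   | a , a∈Pj , _ , ¬adj-a with ∃-non-neighbour j≢part a∈Pj
  ...     | b , b∈Pj , b≢a , ¬adj-b = subst (_ ≤_) (∣P∣≡v j)
    (two-missing⇒2+∣p∣≤∣q∣ (p∩q⊆q _ _) a∈Pj b∈Pj
                           (not-neighbour ¬adj-a) (not-neighbour ¬adj-b) b≢a)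
    where
    not-neighbour : ∀ {z} → ¬ Adjacent G x z → z ∉ neighbours G x ∩ P j
    not-neighbour ¬adj z∈ = ¬adj (neighbours-adjacent G (proj₁ (x∈p∩q⁻ _ _ z∈)))

  degree≤ : ∀ x → degree G x ≤ suc (n * (v ∸ 2))
  degree≤ x = ≤-trans (∣p∣≤∑∣p∩P∣ (λ y → part y , x∈part y) (neighbours G x))
    (∑≤*+1 (λ j → ∣ neighbours G x ∩ P j ∣) (part x)
      (<v⇒≤suc[v∸2] 2≤v (neighbours-in-own-part x))
      (λ j j≢part → 2+m≤v⇒m≤v∸2 (neighbours-in-other-part j≢part)))
    where
    <v⇒≤suc[v∸2] : ∀ {m v} → 2 ≤ v → m < v → m ≤ suc (v ∸ 2)
    <v⇒≤suc[v∸2] {v = suc (suc _)} _ (s≤s m≤) = m≤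
    <v⇒≤suc[v∸2] {v = suc zero}    (s≤s ()) _
    2+m≤v⇒m≤v∸2 : ∀ {m v} → 2 + m ≤ v → m ≤ v ∸ 2
    2+m≤v⇒m≤v∸2 (s≤s (s≤s m≤)) = m≤

lemma2p1 : (n v : ℕ) → 2 ≤ n → 2 ≤ v → (G : Graph (n * v)) →
    StronglyCliquePartitioned n v G →
    2 * edgeCount G ≤ n * (v * (v ∸ 1)) + n * v * (n ∸ 1) * (v ∸ 2)
lemma2p1 n v _ 2≤v G (P , partition , _ , only-parts) = begin
  2 * edgeCount G                                 ≤⟨ 2*edgeCount≤ G degree≤ ⟩
  n * v * suc (n * (v ∸ 2))                       ≡⟨ rearrange n v 2≤v ⟩
  n * (v * (v ∸ 1)) + n * v * (n ∸ 1) * (v ∸ 2)   ∎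
  where
  open ≤-Reasoning
  open StronglyPartitioned G P partition only-parts 2≤v
  rearrange : ∀ n v → 2 ≤ v →
    n * v * suc (n * (v ∸ 2)) ≡ n * (v * (v ∸ 1)) + n * v * (n ∸ 1) * (v ∸ 2)
  rearrange zero    v              _        = refl
  rearrange (suc n) (suc zero)     (s≤s ())
  rearrange (suc n) (suc (suc v)) _        = ring n v
    where
    ring : ∀ n v → suc n * suc (suc v) * suc (suc n * v)
                 ≡ suc n * (suc (suc v) * suc v) + suc n * suc (suc v) * n * v
    ring = solve-∀
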